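{- Consider an instance of the Penalized Knapsack Problem with items indexed so that $\pi_1\ge\pi_2\ge\dots\ge\pi_n$. Let $KP_1$ be the 0--1 knapsack problem obtained by ignoring the penalties (maximize $\sum_j p_jx_j$ s.t. $\sum_j w_jx_j\le c$, $x\in\{0,1\}^n$), take a nonempty optimal solution of $KP_1$, and let $\overline{f}$ be the smallest index of an item in it. Then all items $j=1,\dots,\overline{f}-1$ can be discarded without loss of optimality, i.e. the Penalized Knapsack Problem has an optimal solution with $x_j=0$ for all $j<\overline{f}$.
   Context: The Penalized Knapsack Problem: given $n$ items with non-negative integer profits $p_j$, weights $w_j$, penalties $\pi_j$ and a capacity $c$, choose $x\in\{0,1\}^n$ with $\sum_j w_jx_j\le c$ maximizing $\sum_j p_jx_j-\max\{\pi_j:x_j=1\}$ (the maximum over the empty set being $0$). -}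

module Defs where

open import Data.Nat using (ℕ; zero; suc; _+_; _≤_; _⊔_)
open import Data.Integer as ℤ using (ℤ; +_; _-_)
open import Data.Bool using (Bool; true; false; if_then_else_)
open import Data.Fin using (Fin; toℕ)
import Data.Fin as F
open import Data.Product using (_×_; Σ)
open import Relation.Binary.PropositionalEquality using (_≡_)

sumFin : ∀ {n} → (Fin n → ℕ) → ℕ
sumFin {zero}  f = 0
sumFin {suc n} f = f F.zero + sumFin (λ j → f (F.suc j))

maxFin : ∀ {n} → (Fin n → ℕ) → ℕ
maxFin {zero}  f = 0
maxFin {suc n} f = f F.zero ⊔ maxFin (λ j → f (F.suc j))

sel : Bool → ℕ → ℕ
sel b v = if b then v else 0

weight : ∀ {n} → (Fin n → ℕ) → (Fin n → Bool) → ℕ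
weight w x = sumFin (λ j → sel (x j) (w j))

profit : ∀ {n} → (Fin n → ℕ) → (Fin n → Bool) → ℕ
profit p x = sumFin (λ j → sel (x j) (p j))

-- max { π_j : x_j = 1 }, with max ∅ = 0 (penalties are ≥ 0)
maxPenalty : ∀ {n} → (Fin n → ℕ) → (Fin n → Bool) → ℕ
maxPenalty π x = maxFin (λ j → sel (x j) (π j))

feasible : ∀ {n} → (Fin n → ℕ) → ℕ → (Fin n → Bool) → Set
feasible w c x = weight w x ≤ c

pkpValue : ∀ {n} → (Fin n → ℕ) → (Fin n → ℕ) → (Fin n → Bool) → ℤ
pkpValue p π x = + profit p x - + maxPenalty π x

KP1-optimal : ∀ {n} → (p w : Fin n → ℕ) → ℕ → (Fin n → Bool) → Set
KP1-optimal p w c x =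
  feasible w c x × (∀ y → feasible w c y → profit p y ≤ profit p x)

PKP-optimal : ∀ {n} → (p w π : Fin n → ℕ) → ℕ → (Fin n → Bool) → Set
PKP-optimal p w π c x =
  feasible w c x × (∀ y → feasible w c y → pkpValue p π y ℤ.≤ pkpValue p π x)

module Submission where

-- Let y be the given KP₁-optimum whose first item is f.  Since the
-- penalties are non-increasing in the index and y selects only items ≥ f,
-- its penalty is at most π f.  Any feasible x that selects some item j < f
-- pays a penalty ≥ π j ≥ π f, while earning no more profit than y (y is
-- optimal for KP₁).  Hence such an x is never better than y for the PKP.
-- So take any PKP-optimum x: either x already avoids all items j < f, or
-- y is at least as good as x and is therefore itself a PKP-optimum that
-- avoids them.

open import Defs
open import Data.Nat using (ℕ; _≤_; _<_)
open import Data.Bool using (Bool; true; false)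
open import Data.Fin using (Fin; toℕ)
open import Data.Product using (_×_; ∃)
open import Relation.Binary.PropositionalEquality using (_≡_)

open import Data.Nat using (zero; suc; _+_; _⊔_; z≤n)
import Data.Nat.Properties as ℕ
import Data.Fin as Fin
import Data.Fin.Properties as Fin
open import Data.Integer as ℤ using (ℤ; +_; _-_; +≤+)
import Data.Integer.Properties as ℤ
open import Data.Bool using (_≟_)
open import Data.Bool.Properties using (¬-not; not-¬)
open import Data.List using (List; []; _∷_; filter; cartesianProductWith)
open import Data.List.Membership.Propositional using (_∈_)
open import Data.List.Membership.Propositional.Properties
  using (∈-filter⁺; ∈-cartesianProductWith⁺)
open import Data.List.Relation.Unary.All using (lookup)
open import Data.List.Relation.Unary.All.Properties using (all-filter)
open import Data.List.Relation.Unary.Any using (here; there)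
import Data.List.Extrema ℤ.≤-totalOrder as Extrema
open import Data.Vec.Functional as Vector using (Vector)
open import Data.Product using (_,_; ∃-syntax)
open import Relation.Nullary using (yes; no)
open import Relation.Nullary.Decidable using (_×-dec_)
open import Level using (0ℓ)
open import Relation.Unary using (Pred; Decidable)
open import Relation.Binary.PropositionalEquality
  using (refl; sym; trans; cong; cong₂; subst; _≗_)

vectors : ∀ {A : Set} → List A → (n : ℕ) → List (Vector A n)
vectors as zero    = Vector.[] ∷ []
vectors as (suc n) = cartesianProductWith Vector._∷_ as (vectors as n)

vectors-complete : ∀ {A : Set} {as : List A} → (∀ a → a ∈ as) →
                   ∀ {n} (x : Vector A n) → ∃[ z ] z ∈ vectors as n × x ≗ z
vectors-complete all {zero}  x = Vector.[] , here refl , λ ()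
vectors-complete all {suc n} x with vectors-complete all (Vector.tail x)
... | z , z∈ , x≗z =
  Vector.head x Vector.∷ z ,
  ∈-cartesianProductWith⁺ Vector._∷_ (all (Vector.head x)) z∈ ,
  λ { Fin.zero → refl ; (Fin.suc i) → x≗z i }

bools : List Bool
bools = true ∷ false ∷ []

bools-complete : ∀ b → b ∈ bools
bools-complete true  = here refl
bools-complete false = there (here refl)

maximiser-in-list : ∀ {A : Set} {P : Pred A 0ℓ} → Decidable P → (g : A → ℤ) →
  (xs : List A) → ∀ y → P y →
  ∃[ x ] P x × (∀ z → z ∈ xs → P z → g z ℤ.≤ g x)
maximiser-in-list {A} P? g xs y Py =
  best , Extrema.argmax-all g Py (all-filter P? xs) ,
  λ z z∈xs Pz → lookup (Extrema.f[xs]≤f[argmax] y (filter P? xs)) (∈-filter⁺ P? z∈xs Pz)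
  where
  best : A
  best = Extrema.argmax g y (filter P? xs)

vector-optimum : ∀ {A : Set} {as : List A} → (∀ a → a ∈ as) →
  ∀ {n} {P : Pred (Vector A n) 0ℓ} → Decidable P →
  (∀ {x z} → x ≗ z → P x → P z) →
  (g : Vector A n → ℤ) → (∀ {x z} → x ≗ z → g x ≡ g z) →
  ∀ y → P y → ∃[ x ] P x × (∀ z → P z → g z ℤ.≤ g x)
vector-optimum {as = as} as-complete {n} {P} P? P-ext g g-ext y Py
  with maximiser-in-list P? g (vectors as n) y Py
... | x , Px , x-max = x , Px , bound
  where
  bound : ∀ z → P z → g z ℤ.≤ g x
  bound z Pz with vectors-complete as-complete z
  ... | z′ , z′∈ , z≗z′ =
    ℤ.≤-trans (ℤ.≤-reflexive (g-ext z≗z′)) (x-max z′ z′∈ (P-ext z≗z′ Pz))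

sumFin-cong : ∀ {n} {f g : Fin n → ℕ} → f ≗ g → sumFin f ≡ sumFin g
sumFin-cong {zero}  e = refl
sumFin-cong {suc n} e = cong₂ _+_ (e Fin.zero) (sumFin-cong (λ i → e (Fin.suc i)))

maxFin-cong : ∀ {n} {f g : Fin n → ℕ} → f ≗ g → maxFin f ≡ maxFin g
maxFin-cong {zero}  e = refl
maxFin-cong {suc n} e = cong₂ _⊔_ (e Fin.zero) (maxFin-cong (λ i → e (Fin.suc i)))

maxFin-upper : ∀ {n} (h : Fin n → ℕ) j → h j ≤ maxFin h
maxFin-upper h Fin.zero    = ℕ.m≤m⊔n _ _
maxFin-upper h (Fin.suc j) =
  ℕ.≤-trans (maxFin-upper (λ i → h (Fin.suc i)) j) (ℕ.m≤n⊔m (h Fin.zero) _)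

maxFin-least : ∀ {n} (h : Fin n → ℕ) {m} → (∀ j → h j ≤ m) → maxFin h ≤ m
maxFin-least {zero}  h b = z≤n
maxFin-least {suc n} h b =
  ℕ.⊔-lub (b Fin.zero) (maxFin-least (λ i → h (Fin.suc i)) (λ i → b (Fin.suc i)))

sel-cong : ∀ {n} {x z : Fin n → Bool} (v : Fin n → ℕ) → x ≗ z →
           (λ j → sel (x j) (v j)) ≗ (λ j → sel (z j) (v j))
sel-cong v e j = cong (λ b → sel b (v j)) (e j)

feasible-ext : ∀ {n} (w : Fin n → ℕ) c {x z} → x ≗ z → feasible w c x → feasible w c z
feasible-ext w c e = subst (_≤ c) (sumFin-cong (sel-cong w e))

pkpValue-ext : ∀ {n} (p π : Fin n → ℕ) {x z} → x ≗ z → pkpValue p π x ≡ pkpValue p π z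
pkpValue-ext p π e =
  cong₂ (λ a b → + a - + b) (sumFin-cong (sel-cong p e)) (maxFin-cong (sel-cong π e))

penalty-of-selected : ∀ {n} (π : Fin n → ℕ) (x : Fin n → Bool) j →
                      x j ≡ true → π j ≤ maxPenalty π x
penalty-of-selected π x j xj =
  subst (λ b → sel b (π j) ≤ maxPenalty π x) xj (maxFin-upper _ j)

penalty-bounded : ∀ {n} (π : Fin n → ℕ) (x : Fin n → Bool) {m} →
                  (∀ j → x j ≡ true → π j ≤ m) → maxPenalty π x ≤ m
penalty-bounded π x {m} bounded = maxFin-least _ (λ j → bound j (x j) refl)
  where
  bound : ∀ j b → x j ≡ b → sel (x j) (π j) ≤ m
  bound j true  e rewrite e = bounded j e
  bound j false e rewrite e = z≤n

value-mono : ∀ {a a′ b b′} → a ≤ a′ → b′ ≤ b → + a - + b ℤ.≤ + a′ - + b′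
value-mono a≤a′ b′≤b = ℤ.+-mono-≤ (+≤+ a≤a′) (ℤ.neg-mono-≤ (+≤+ b′≤b))

early-item-no-better : ∀ {n} (p w π : Fin n → ℕ) c →
  (∀ (i j : Fin n) → toℕ i ≤ toℕ j → π j ≤ π i) →
  ∀ y → KP1-optimal p w c y →
  ∀ f → (∀ j → toℕ j < toℕ f → y j ≡ false) →
  ∀ x → feasible w c x → ∀ j₀ → toℕ j₀ < toℕ f → x j₀ ≡ true →
  pkpValue p π x ℤ.≤ pkpValue p π y
early-item-no-better p w π c antitone y (_ , y-max) f y-late x x-feas j₀ j₀<f xj₀ =
  value-mono (y-max x x-feas) (ℕ.≤-trans penalty-y≤πf πf≤penalty-x)
  where
  penalty-y≤πf : maxPenalty π y ≤ π f
  penalty-y≤πf = penalty-bounded π y λ j yj → antitone f j (ℕ.≮⇒≥ λ j<f →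
    not-¬ refl (trans (sym yj) (y-late j j<f)))

  πf≤penalty-x : π f ≤ maxPenalty π x
  πf≤penalty-x = ℕ.≤-trans (antitone j₀ f (ℕ.<⇒≤ j₀<f)) (penalty-of-selected π x j₀ xj₀)

proposition4 : ∀ {n} (p w π : Fin n → ℕ) (c : ℕ)
    → (∀ (i j : Fin n) → toℕ i ≤ toℕ j → π j ≤ π i)
    → (y : Fin n → Bool) → KP1-optimal p w c y
    → (f : Fin n) → y f ≡ true → (∀ (j : Fin n) → toℕ j < toℕ f → y j ≡ false)
    → ∃ λ (x : Fin n → Bool) → PKP-optimal p w π c x
    × (∀ (j : Fin n) → toℕ j < toℕ f → x j ≡ false)
proposition4 p w π c antitone y y-opt@(y-feas , _) f _ y-late
  with vector-optimum bools-complete (λ x → weight w x ℕ.≤? c) (feasible-ext w c)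
         (pkpValue p π) (pkpValue-ext p π) y y-feas
... | x , x-feas , x-max
  with Fin.any? (λ j → (toℕ j ℕ.<? toℕ f) ×-dec (x j ≟ true))
... | yes (j₀ , j₀<f , xj₀) =
  y , (y-feas , λ z z-feas → ℤ.≤-trans (x-max z z-feas)
         (early-item-no-better p w π c antitone y y-opt f y-late x x-feas j₀ j₀<f xj₀))
    , y-late
... | no no-early = x , (x-feas , x-max) , λ j j<f → ¬-not λ xj → no-early (j , j<f , xj)
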